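{- For every positive integer $n$ and every permutation $a$ of $[n]=\{1,\dots,n\}$ we have $|S(a)|\ge\frac{n^{3/2}}{4\sqrt2}$.
   Context: For a sequence $a=(a_i)_{i=1}^n$ of integers, $S(a)$ denotes the set of all distinct values of the sums $\sum_{i=u}^v a_i$ with $1\le u\le v\le n$. -}

module Defs where

open import Data.Nat using (ℕ; zero; suc; _+_; _*_; _≟_)
open import Data.Fin using (Fin; toℕ)
import Data.Fin
open import Data.Fin.Permutation using (Permutation′; _⟨$⟩ʳ_)
open import Data.List using (List; []; _∷_; length; deduplicate; upTo; concatMap; map; drop)
open import Data.Nat.ListAction using (sum)

-- A sequence of length n is a function Fin n → ℕ (entries a₁,…,aₙ are
-- at 0-based positions 0,…,n-1).

-- value at 0-based position i (0 if out of range; never used out of range)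
at : {n : ℕ} → (Fin n → ℕ) → ℕ → ℕ
at {zero}  a i       = 0
at {suc n} a zero    = a Data.Fin.zero
at {suc n} a (suc i) = at {n} (λ j → a (Data.Fin.suc j)) i

blockSum : {n : ℕ} → (Fin n → ℕ) → ℕ → ℕ → ℕ
blockSum a u v = sum (map (at a) (drop u (upTo (suc v))))

allBlockSums : {n : ℕ} → (Fin n → ℕ) → List ℕ
allBlockSums {n} a =
  concatMap (λ v → map (λ u → blockSum a u v) (upTo (suc v))) (upTo n)

S : {n : ℕ} → (Fin n → ℕ) → List ℕ
S a = deduplicate _≟_ (allBlockSums a)

card-S : {n : ℕ} → (Fin n → ℕ) → ℕ
card-S a = length (S a)

-- the sequence (π(1),…,π(n)) of a permutation π of [n] = {1,…,n},
-- where Fin n = {0,…,n-1} is identified with [n] via k ↦ k+1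
permSeq : {n : ℕ} → Permutation′ n → Fin n → ℕ
permSeq π i = suc (toℕ (π ⟨$⟩ʳ i))

-- Let P₀ < P₁ < … < Pₙ = n(n+1)/2 be the prefix sums of the permutation, so that S(a) is the
-- set of differences P_k − P_u with u < k, and let s_j count the elements of S(a) in the window
-- (jn, (j+1)n].  Window 0 contains all n entries, so s₀ ≥ n.  For h = ⌊n/2⌋, j < h and u < h − j,
-- let k be the last index with P_k ≤ P_u + (j+1)n: then P_k − P_u lies in window j and
-- P_{k+1} − P_u in window j+1, and this pair determines u, since its difference a_k determines k.
-- Hence h − j ≤ s_j s_{j+1}, so s_j + s_{j+1} ≥ 2⌊√(h−j)⌋ by AM–GM, and summing over j gives
-- 2|S(a)| ≥ G(n) = n + 2 ∑_{t ≤ h} ⌊√t⌋.  An induction in steps of two shows n³ ≤ 8 G(n)².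
module Submission where

open import Data.Nat
open import Data.Nat.Properties
open import Data.Nat.Tactic.RingSolver using (solve-∀)
open import Data.Nat.ListAction using (sum)
open import Data.Nat.ListAction.Properties using (sum-++)
open import Data.Product using (_×_; _,_; proj₁; proj₂)
open import Data.Sum using (_⊎_; inj₁; inj₂; [_,_]′)
open import Data.Empty using (⊥-elim)
open import Data.Fin as Fin using (Fin; toℕ; fromℕ<)
open import Data.Fin.Properties
  using (toℕ<n; toℕ-injective; toℕ-fromℕ<; fromℕ<-injective; injective⇒≤)
open import Data.Fin.Permutation using (Permutation′; _⟨$⟩ʳ_; _⟨$⟩ˡ_; inverseˡ)
open import Data.List
  using ( List; []; _∷_; [_]; length; map; _++_; _∷ʳ_; filter; take; drop; upTo; applyUpTo
        ; lookup; cartesianProduct)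
open import Data.List.Properties
  using (length-++; length-map; filter-accept; filter-reject; filter-++; map-++; upTo-∷ʳ; take++drop≡id)
open import Data.List.Membership.Propositional using (_∈_; lose)
open import Data.List.Membership.Propositional.Properties
  using (∈-map⁺; ∈-concatMap⁺; ∈-upTo⁺; ∈-deduplicate⁺; ∈-filter⁺; ∈-cartesianProduct⁺)
open import Data.List.Relation.Unary.Any using (index)
open import Data.List.Relation.Unary.Any.Properties using (lookup-index)
import Algebra.Properties.CommutativeMonoid.Sum as CommutativeMonoidSum
open import Function using (_∘_; id; flip)
open import Relation.Nullary using (Dec; yes; no)
open import Relation.Nullary.Decidable using (_×-dec_)
open import Relation.Binary.Definitions using (tri<; tri≈; tri>)
open import Relation.Binary.PropositionalEquality hiding ([_])

open import Defs

infixl 10 ∑<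

∑< : ℕ → (ℕ → ℕ) → ℕ
∑< zero    f = 0
∑< (suc m) f = ∑< m f + f m

syntax ∑< m (λ j → e) = ∑[ j < m ] e

∑<-cong : ∀ m {f g : ℕ → ℕ} → (∀ {j} → j < m → f j ≡ g j) → ∑< m f ≡ ∑< m g
∑<-cong zero    eq = refl
∑<-cong (suc m) eq = cong₂ _+_ (∑<-cong m (eq ∘ m<n⇒m<1+n)) (eq ≤-refl)

∑<-mono-≤ : ∀ m {f g : ℕ → ℕ} → (∀ {j} → j < m → f j ≤ g j) → ∑< m f ≤ ∑< m g
∑<-mono-≤ zero    le = z≤n
∑<-mono-≤ (suc m) le = +-mono-≤ (∑<-mono-≤ m (λ j<m → le (m<n⇒m<1+n j<m))) (le ≤-refl)

∑<-monoˡ-≤ : ∀ (f : ℕ → ℕ) {m k} → m ≤ k → ∑< m f ≤ ∑< k f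
∑<-monoˡ-≤ f {k = zero}  z≤n = z≤n
∑<-monoˡ-≤ f {m} {suc k} m≤1+k with m ≤? k
... | yes m≤k = ≤-trans (∑<-monoˡ-≤ f m≤k) (m≤m+n (∑< k f) (f k))
... | no  m≰k = ≤-reflexive (cong (λ i → ∑< i f) (≤-antisym m≤1+k (≰⇒> m≰k)))

∑<-≤-* : ∀ m {f : ℕ → ℕ} {c} → (∀ {j} → j < m → f j ≤ c) → ∑< m f ≤ m * c
∑<-≤-* zero    le = z≤n
∑<-≤-* (suc m) {f} {c} le = begin
  ∑< m f + f m ≤⟨ +-mono-≤ (∑<-≤-* m (λ j<m → le (m<n⇒m<1+n j<m))) (le ≤-refl) ⟩
  m * c + c    ≡⟨ +-comm (m * c) c ⟩
  suc m * c    ∎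
  where open ≤-Reasoning

∑<-distrib-+ : ∀ m (f g : ℕ → ℕ) → ∑[ j < m ] (f j + g j) ≡ ∑< m f + ∑< m g
∑<-distrib-+ zero    f g = refl
∑<-distrib-+ (suc m) f g = begin
  ∑[ j < m ] (f j + g j) + (f m + g m)   ≡⟨ cong (_+ (f m + g m)) (∑<-distrib-+ m f g) ⟩
  ∑< m f + ∑< m g + (f m + g m)          ≡⟨ +-assoc-swap (∑< m f) (∑< m g) (f m) (g m) ⟩
  ∑< m f + f m + (∑< m g + g m)          ∎
  where
  open ≡-Reasoning
  +-assoc-swap : ∀ a b c d → a + b + (c + d) ≡ a + c + (b + d)
  +-assoc-swap = solve-∀

∑<-zero : ∀ m → ∑< m (λ _ → 0) ≡ 0
∑<-zero zero    = refl
∑<-zero (suc m) = trans (+-identityʳ _) (∑<-zero m)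

∑<-cons : ∀ m (f : ℕ → ℕ) → ∑< (suc m) f ≡ f 0 + ∑[ j < m ] f (suc j)
∑<-cons zero    f = +-comm 0 (f 0)
∑<-cons (suc m) f = begin
  ∑< (suc m) f + f (suc m)                   ≡⟨ cong (_+ f (suc m)) (∑<-cons m f) ⟩
  f 0 + ∑[ j < m ] f (suc j) + f (suc m)     ≡⟨ +-assoc (f 0) _ _ ⟩
  f 0 + ∑[ j < suc m ] f (suc j)             ∎
  where open ≡-Reasoning

∑<-reverse : ∀ m (f : ℕ → ℕ) → ∑[ j < m ] f (m ∸ j) ≡ ∑[ j < m ] f (suc j)
∑<-reverse zero    f = refl
∑<-reverse (suc m) f = begin
  ∑[ j < suc m ] f (suc m ∸ j)           ≡⟨ ∑<-cons m (λ j → f (suc m ∸ j)) ⟩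
  f (suc m) + ∑[ j < m ] f (m ∸ j)       ≡⟨ cong (f (suc m) +_) (∑<-reverse m f) ⟩
  f (suc m) + ∑[ j < m ] f (suc j)       ≡⟨ +-comm (f (suc m)) _ ⟩
  ∑[ j < suc m ] f (suc j)               ∎
  where open ≡-Reasoning

∑<-adjacent : ∀ m (g : ℕ → ℕ) → g 0 + ∑[ j < m ] (g j + g (suc j)) ≤ 2 * ∑< (suc m) g
∑<-adjacent m g = begin
  g 0 + ∑[ j < m ] (g j + g (suc j))         ≡⟨ cong (g 0 +_) (∑<-distrib-+ m g (g ∘ suc)) ⟩
  g 0 + (∑< m g + ∑[ j < m ] g (suc j))      ≡⟨ +-comm-middle (g 0) (∑< m g) _ ⟩
  ∑< m g + (g 0 + ∑[ j < m ] g (suc j))      ≡⟨ cong (∑< m g +_) (∑<-cons m g) ⟨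
  ∑< m g + ∑< (suc m) g                      ≤⟨ +-monoˡ-≤ (∑< (suc m) g) (m≤m+n (∑< m g) (g m)) ⟩
  ∑< (suc m) g + ∑< (suc m) g                ≡⟨ cong (∑< (suc m) g +_) (+-identityʳ _) ⟨
  2 * ∑< (suc m) g                           ∎
  where
  open ≤-Reasoning
  +-comm-middle : ∀ a b c → a + (b + c) ≡ b + (a + c)
  +-comm-middle = solve-∀

2*∑[1+j]≡m*[1+m] : ∀ m → 2 * ∑[ j < m ] suc j ≡ m * suc m
2*∑[1+j]≡m*[1+m] zero    = refl
2*∑[1+j]≡m*[1+m] (suc m) = begin
  2 * (∑[ j < m ] suc j + suc m)    ≡⟨ *-distribˡ-+ 2 (∑[ j < m ] suc j) (suc m) ⟩
  2 * ∑[ j < m ] suc j + 2 * suc m  ≡⟨ cong (_+ 2 * suc m) (2*∑[1+j]≡m*[1+m] m) ⟩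
  m * suc m + 2 * suc m             ≡⟨ *-distribʳ-+ (suc m) m 2 ⟨
  (m + 2) * suc m                   ≡⟨ *-comm (m + 2) (suc m) ⟩
  suc m * (m + 2)                   ≡⟨ cong (suc m *_) (+-comm m 2) ⟩
  suc m * suc (suc m)               ∎
  where open ≡-Reasoning

⌊√_⌋ : ℕ → ℕ
⌊√ zero ⌋  = zero
⌊√ suc t ⌋ with suc ⌊√ t ⌋ ^ 2 ≤? suc t
... | yes _ = suc ⌊√ t ⌋
... | no  _ = ⌊√ t ⌋

⌊√⌋-spec : ∀ t → ⌊√ t ⌋ ^ 2 ≤ t × t < suc ⌊√ t ⌋ ^ 2
⌊√⌋-spec zero = z≤n , s≤s z≤n
⌊√⌋-spec (suc t) with suc ⌊√ t ⌋ ^ 2 ≤? suc t | ⌊√⌋-spec t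
... | yes r²≤ | _ , t<r² = r²≤ , ≤-trans (s≤s t<r²) (^-monoˡ-< 2 (n<1+n (suc ⌊√ t ⌋)))
... | no  r²≰ | r²≤ , _  = m≤n⇒m≤1+n r²≤ , ≰⇒> r²≰

m^2≤n^2⇒m≤n : ∀ m n → m ^ 2 ≤ n ^ 2 → m ≤ n
m^2≤n^2⇒m≤n m n m²≤n² with m ≤? n
... | yes m≤n = m≤n
... | no  m≰n = ⊥-elim (<⇒≱ (^-monoˡ-< 2 (≰⇒> m≰n)) m²≤n²)

-- The ring solver does not handle _^_; the identities below spell out k ^ 2 as k * (k * 1).
4xy≤[x+y]^2 : ∀ x y → 4 * (x * y) ≤ (x + y) ^ 2
4xy≤[x+y]^2 x y = [ ordered , swapped ]′ (≤-total x y)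
  where
  ordered : ∀ {x y} → x ≤ y → 4 * (x * y) ≤ (x + y) ^ 2
  ordered {x} x≤y with d , refl ← m≤n⇒∃[o]m+o≡n x≤y =
    ≤-trans (m≤m+n _ (d * d)) (≤-reflexive (square-expand x d))
    where
    square-expand : ∀ x d → 4 * (x * (x + d)) + d * d ≡ (x + (x + d)) * ((x + (x + d)) * 1)
    square-expand = solve-∀
  swapped : y ≤ x → 4 * (x * y) ≤ (x + y) ^ 2
  swapped y≤x = subst₂ _≤_ (cong (4 *_) (*-comm y x)) (cong (_^ 2) (+-comm y x)) (ordered y≤x)

am-gm : ∀ k x y → k ^ 2 ≤ x * y → 2 * k ≤ x + y
am-gm k x y k²≤xy = m^2≤n^2⇒m≤n (2 * k) (x + y) (begin
  (2 * k) ^ 2    ≡⟨ square-double k ⟩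
  4 * k ^ 2      ≤⟨ *-monoʳ-≤ 4 k²≤xy ⟩
  4 * (x * y)    ≤⟨ 4xy≤[x+y]^2 x y ⟩
  (x + y) ^ 2    ∎)
  where
  open ≤-Reasoning
  square-double : ∀ k → 2 * k * (2 * k * 1) ≡ 4 * (k * (k * 1))
  square-double = solve-∀

G : ℕ → ℕ
G n = n + ∑[ t < ⌊ n /2⌋ ] (2 * ⌊√ suc t ⌋)

G-step : ∀ n → G (2 + n) ≡ G n + 2 * suc ⌊√ suc ⌊ n /2⌋ ⌋
G-step n = regroup n (∑[ t < ⌊ n /2⌋ ] (2 * ⌊√ suc t ⌋)) ⌊√ suc ⌊ n /2⌋ ⌋
  where
  regroup : ∀ n s r → 2 + n + (s + 2 * r) ≡ n + s + 2 * suc r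
  regroup = solve-∀

n<2*[1+⌊n/2⌋] : ∀ n → n < 2 * suc ⌊ n /2⌋
n<2*[1+⌊n/2⌋] zero          = s≤s z≤n
n<2*[1+⌊n/2⌋] (suc zero)    = s≤s (s≤s z≤n)
n<2*[1+⌊n/2⌋] (suc (suc n)) =
  subst (2 + n <_) (sym (*-suc 2 (suc ⌊ n /2⌋))) (s≤s (s≤s (n<2*[1+⌊n/2⌋] n)))

2*⌊n/2⌋≤n : ∀ n → 2 * ⌊ n /2⌋ ≤ n
2*⌊n/2⌋≤n zero          = z≤n
2*⌊n/2⌋≤n (suc zero)    = z≤n
2*⌊n/2⌋≤n (suc (suc n)) =
  subst (_≤ 2 + n) (sym (*-suc 2 ⌊ n /2⌋)) (s≤s (s≤s (2*⌊n/2⌋≤n n)))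

n²≤4gx : ∀ n g x → n ^ 3 ≤ 8 * g ^ 2 → suc n ≤ 2 * x ^ 2 → n * n ≤ 4 * (g * x)
n²≤4gx n g x n³≤8g² n<2x² = m^2≤n^2⇒m≤n (n * n) (4 * (g * x)) (begin
  (n * n) ^ 2                    ≡⟨ regroup-n⁴ n ⟩
  n ^ 3 * n                      ≤⟨ *-monoʳ-≤ (n ^ 3) (≤-trans (n≤1+n n) n<2x²) ⟩
  n ^ 3 * (2 * x ^ 2)            ≤⟨ *-monoˡ-≤ (2 * x ^ 2) n³≤8g² ⟩
  8 * g ^ 2 * (2 * x ^ 2)        ≡⟨ regroup-g²x² g x ⟩
  (4 * (g * x)) ^ 2              ∎)
  where
  open ≤-Reasoning
  regroup-n⁴ : ∀ n → (n * n) * ((n * n) * 1) ≡ n * (n * (n * 1)) * n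
  regroup-n⁴ = solve-∀
  regroup-g²x² : ∀ g x → 8 * (g * (g * 1)) * (2 * (x * (x * 1))) ≡
                         (4 * (g * x)) * ((4 * (g * x)) * 1)
  regroup-g²x² = solve-∀

cube-step : ∀ n g x → n ^ 3 ≤ 8 * g ^ 2 → suc n ≤ 2 * x ^ 2 →
            (2 + n) ^ 3 ≤ 8 * (g + 2 * x) ^ 2
cube-step n g x n³≤8g² n<2x² = begin
  (2 + n) ^ 3                                       ≡⟨ expand-cube n ⟩
  n ^ 3 + 6 * (n * n) + (12 * n + 8)                ≤⟨ +-mono-≤ (+-mono-≤ n³≤8g² 6n²≤8y) 12n+8≤32x² ⟩
  8 * g ^ 2 + 8 * (4 * (g * x)) + 16 * (2 * x ^ 2)  ≡⟨ expand-square g x ⟩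
  8 * (g + 2 * x) ^ 2                               ∎
  where
  open ≤-Reasoning
  expand-cube : ∀ n → (2 + n) * ((2 + n) * ((2 + n) * 1)) ≡
                      n * (n * (n * 1)) + 6 * (n * n) + (12 * n + 8)
  expand-cube = solve-∀
  expand-square : ∀ g x → 8 * (g * (g * 1)) + 8 * (4 * (g * x)) + 16 * (2 * (x * (x * 1))) ≡
                          8 * ((g + 2 * x) * ((g + 2 * x) * 1))
  expand-square = solve-∀
  regroup-16 : ∀ n → 12 * n + 8 + (4 * n + 8) ≡ 16 * suc n
  regroup-16 = solve-∀
  6n²≤8y : 6 * (n * n) ≤ 8 * (4 * (g * x))
  6n²≤8y = ≤-trans (*-monoʳ-≤ 6 (n²≤4gx n g x n³≤8g² n<2x²)) (*-monoˡ-≤ (4 * (g * x)) (m≤m+n 6 2))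
  12n+8≤32x² : 12 * n + 8 ≤ 16 * (2 * x ^ 2)
  12n+8≤32x² = begin
    12 * n + 8                  ≤⟨ m≤m+n (12 * n + 8) (4 * n + 8) ⟩
    12 * n + 8 + (4 * n + 8)    ≡⟨ regroup-16 n ⟩
    16 * suc n                  ≤⟨ *-monoʳ-≤ 16 n<2x² ⟩
    16 * (2 * x ^ 2)            ∎

n^3≤8*G^2 : ∀ n → n ^ 3 ≤ 8 * G n ^ 2
n^3≤8*G^2 zero          = z≤n
n^3≤8*G^2 (suc zero)    = s≤s z≤n
n^3≤8*G^2 (suc (suc n)) = subst (λ g → (2 + n) ^ 3 ≤ 8 * g ^ 2) (sym (G-step n))
  (cube-step n (G n) x (n^3≤8*G^2 n) 1+n≤2x²)
  where
  x : ℕ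
  x = suc ⌊√ suc ⌊ n /2⌋ ⌋
  1+n≤2x² : suc n ≤ 2 * x ^ 2
  1+n≤2x² = ≤-trans (n<2*[1+⌊n/2⌋] n) (*-monoʳ-≤ 2 (<⇒≤ (proj₂ (⌊√⌋-spec (suc ⌊ n /2⌋)))))

injective-below⇒≤-length : ∀ {B : Set} (f : ℕ → B) {m} {ys : List B} →
  (∀ {i j} → i < m → j < m → f i ≡ f j → i ≡ j) → (∀ {i} → i < m → f i ∈ ys) →
  m ≤ length ys
injective-below⇒≤-length f {m} {ys} f-inj f∈ys = injective⇒≤ position-injective
  where
  position : Fin m → Fin (length ys)
  position i = index (f∈ys (toℕ<n i))
  position-injective : ∀ {i j} → position i ≡ position j → i ≡ j
  position-injective {i} {j} eq = toℕ-injective (f-inj (toℕ<n i) (toℕ<n j) (begin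
    f (toℕ i)                       ≡⟨ lookup-index (f∈ys (toℕ<n i)) ⟩
    lookup ys (position i) ≡⟨ cong (lookup ys) eq ⟩
    lookup ys (position j) ≡⟨ lookup-index (f∈ys (toℕ<n j)) ⟨
    f (toℕ j)                       ∎))
    where open ≡-Reasoning

length-cartesianProduct : ∀ {A B : Set} (xs : List A) (ys : List B) →
  length (cartesianProduct xs ys) ≡ length xs * length ys
length-cartesianProduct []       ys = refl
length-cartesianProduct (x ∷ xs) ys = trans (length-++ (map (x ,_) ys))
  (cong₂ _+_ (length-map (x ,_) ys) (length-cartesianProduct xs ys))

module Windows (w : ℕ) where

  InWindow : ℕ → ℕ → Set
  InWindow j x = j * w < x × x ≤ suc j * w

  inWindow? : ∀ j x → Dec (InWindow j x)
  inWindow? j x = (j * w <? x) ×-dec (x ≤? suc j * w)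

  ∸-inWindow : ∀ j a {b} → a + j * w < b → b ≤ a + suc j * w → InWindow j (b ∸ a)
  ∸-inWindow j a {b} lower upper =
    m+n≤o⇒m≤o∸n (suc (j * w)) (subst (_≤ b) (cong suc (+-comm a (j * w))) lower) ,
    m≤n+o⇒m∸n≤o b a upper

  within : ℕ → List ℕ → List ℕ
  within j = filter (inWindow? j)

  count : ℕ → List ℕ → ℕ
  count j xs = length (within j xs)

  count-∷ : ∀ j x xs → count j (x ∷ xs) ≡ count j [ x ] + count j xs
  count-∷ j x xs =
    trans (cong length (filter-++ (inWindow? j) [ x ] xs)) (length-++ (within j [ x ]))

  hits : ℕ → ℕ → ℕ
  hits x m = ∑[ j < m ] count j [ x ]

  hits≡0⊎1 : ∀ x m → hits x m ≡ 0 ⊎ (hits x m ≡ 1 × x ≤ m * w)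
  hits≡0⊎1 x zero = inj₁ refl
  hits≡0⊎1 x (suc m) with inWindow? m x | hits≡0⊎1 x m
  ... | yes inW@(_ , x≤) | inj₁ none =
    inj₂ (cong₂ _+_ none (cong length (filter-accept (inWindow? m) inW)) , x≤)
  ... | yes (mw<x , _) | inj₂ (_ , x≤mw) = ⊥-elim (<⇒≱ mw<x x≤mw)
  ... | no ¬inW | inj₁ none =
    inj₁ (cong₂ _+_ none (cong length (filter-reject (inWindow? m) ¬inW)))
  ... | no ¬inW | inj₂ (one , x≤mw) =
    inj₂ ( cong₂ _+_ one (cong length (filter-reject (inWindow? m) ¬inW))
         , ≤-trans x≤mw (m≤n+m (m * w) w))

  hits≤1 : ∀ x m → hits x m ≤ 1
  hits≤1 x m with hits≡0⊎1 x m
  ... | inj₁ none      = ≤-trans (≤-reflexive none) z≤n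
  ... | inj₂ (one , _) = ≤-reflexive one

  ∑<-count≤length : ∀ m xs → ∑[ j < m ] count j xs ≤ length xs
  ∑<-count≤length m []       = ≤-reflexive (∑<-zero m)
  ∑<-count≤length m (x ∷ xs) = begin
    ∑[ j < m ] count j (x ∷ xs)                ≡⟨ ∑<-cong m (λ {j} _ → count-∷ j x xs) ⟩
    ∑[ j < m ] (count j [ x ] + count j xs)    ≡⟨ ∑<-distrib-+ m (λ j → count j [ x ]) (flip count xs) ⟩
    hits x m + ∑[ j < m ] count j xs           ≤⟨ +-mono-≤ (hits≤1 x m) (∑<-count≤length m xs) ⟩
    suc (length xs)                            ∎
    where open ≤-Reasoning

lastBelow : (ℕ → ℕ) → ℕ → ℕ → ℕ
lastBelow P θ zero    = zero
lastBelow P θ (suc m) with P (suc m) ≤? θ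
... | yes _ = suc m
... | no  _ = lastBelow P θ m

lastBelow-self : ∀ (P : ℕ → ℕ) θ m → P m ≤ θ → lastBelow P θ m ≡ m
lastBelow-self P θ zero    _    = refl
lastBelow-self P θ (suc m) Pm≤θ with P (suc m) ≤? θ
... | yes _    = refl
... | no  Pm≰θ = ⊥-elim (Pm≰θ Pm≤θ)

P[lastBelow]≤ : ∀ (P : ℕ → ℕ) θ m → P 0 ≤ θ → P (lastBelow P θ m) ≤ θ
P[lastBelow]≤ P θ zero    P0≤θ = P0≤θ
P[lastBelow]≤ P θ (suc m) P0≤θ with P (suc m) ≤? θ
... | yes Pm≤θ = Pm≤θ
... | no  _    = P[lastBelow]≤ P θ m P0≤θ

lastBelow-crosses : ∀ (P : ℕ → ℕ) θ m → P 0 ≤ θ → θ < P m →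
                    lastBelow P θ m < m × θ < P (suc (lastBelow P θ m))
lastBelow-crosses P θ zero    P0≤θ θ<P0 = ⊥-elim (<⇒≱ θ<P0 P0≤θ)
lastBelow-crosses P θ (suc m) P0≤θ θ<P[1+m] with P (suc m) ≤? θ
... | yes P[1+m]≤θ = ⊥-elim (<⇒≱ θ<P[1+m] P[1+m]≤θ)
... | no  _ with P m ≤? θ
...   | yes Pm≤θ rewrite lastBelow-self P θ m Pm≤θ = n<1+n m , θ<P[1+m]
...   | no  Pm≰θ with k<m , θ<P[1+k] ← lastBelow-crosses P θ m P0≤θ (≰⇒> Pm≰θ) =
  m<n⇒m<1+n k<m , θ<P[1+k]

module BlockSumWindows
  (n : ℕ) (A : ℕ → ℕ)
  (A-pos : ∀ {i} → i < n → 0 < A i)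
  (A≤n : ∀ {i} → i < n → A i ≤ n)
  (A-injective : ∀ {i k} → i < n → k < n → A i ≡ A k → i ≡ k)
  (n[n+1]≤2∑A : n * suc n ≤ 2 * ∑< n A)
  (L : List ℕ)
  (block∈L : ∀ {u k} → u < k → k ≤ n → ∑< k A ∸ ∑< u A ∈ L)
  where

  P : ℕ → ℕ
  P k = ∑< k A

  P-strict : ∀ {i k} → i < k → k ≤ n → P i < P k
  P-strict {i} {k} i<k k≤n = begin-strict
    P i          <⟨ m<m+n (P i) (A-pos (<-≤-trans i<k k≤n)) ⟩
    P i + A i    ≤⟨ ∑<-monoˡ-≤ A i<k ⟩
    P k          ∎
    where open ≤-Reasoning

  P-injective : ∀ {x y} → x ≤ n → y ≤ n → P x ≡ P y → x ≡ y
  P-injective {x} {y} x≤n y≤n Px≡Py with <-cmp x y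
  ... | tri< x<y _ _ = ⊥-elim (<⇒≢ (P-strict x<y y≤n) Px≡Py)
  ... | tri≈ _ x≡y _ = x≡y
  ... | tri> _ _ y<x = ⊥-elim (<⇒≢ (P-strict y<x x≤n) (sym Px≡Py))

  P≤*n : ∀ {k} → k ≤ n → P k ≤ k * n
  P≤*n {k} k≤n = ∑<-≤-* k (λ j<k → A≤n (<-≤-trans j<k k≤n))

  A∈L : ∀ {i} → i < n → A i ∈ L
  A∈L {i} i<n = subst (_∈ L) (m+n∸m≡n (P i) (A i)) (block∈L (n<1+n i) i<n)

  open Windows n

  s : ℕ → ℕ
  s j = count j L

  A-inWindow₀ : ∀ {i} → i < n → InWindow 0 (A i)
  A-inWindow₀ i<n = A-pos i<n , subst (A _ ≤_) (sym (*-identityˡ n)) (A≤n i<n)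

  n≤s₀ : n ≤ s 0
  n≤s₀ = injective-below⇒≤-length A A-injective
    (λ i<n → ∈-filter⁺ (inWindow? 0) (A∈L i<n) (A-inWindow₀ i<n))

  module Crossing (j : ℕ) where

    crossing : ℕ → ℕ
    crossing u = lastBelow P (P u + suc j * n) n

    pair : ℕ → ℕ × ℕ
    pair u = P (crossing u) ∸ P u , P (suc (crossing u)) ∸ P u

    module _ {u : ℕ} (fits : 2 * suc (u + j) ≤ n) where

      private
        θ : ℕ
        θ = P u + suc j * n
        k : ℕ
        k = crossing u

      u<n : u < n
      u<n = ≤-trans (s≤s (m≤m+n u j)) (≤-trans (m≤m+n (suc (u + j)) _) fits)

      θ<Pn : θ < P n
      θ<Pn = *-cancelˡ-< 2 θ (P n) (begin-strict
        2 * (P u + suc j * n)      ≤⟨ *-monoʳ-≤ 2 (+-monoˡ-≤ (suc j * n) (P≤*n (<⇒≤ u<n))) ⟩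
        2 * (u * n + suc j * n)    ≡⟨ regroup u j n ⟩
        2 * suc (u + j) * n        ≤⟨ *-monoˡ-≤ n fits ⟩
        n * n                      <⟨ *-monoʳ-< n (n<1+n n) ⟩
        n * suc n                  ≤⟨ n[n+1]≤2∑A ⟩
        2 * P n                    ∎)
        where
        open ≤-Reasoning
        instance
          n≢0 : NonZero n
          n≢0 = >-nonZero (≤-trans (s≤s z≤n) fits)
        regroup : ∀ u j n → 2 * (u * n + suc j * n) ≡ 2 * suc (u + j) * n
        regroup = solve-∀

      k<n×θ<P[1+k] : k < n × θ < P (suc k)
      k<n×θ<P[1+k] = lastBelow-crosses P θ n z≤n θ<Pn

      k<n : k < n
      k<n = proj₁ k<n×θ<P[1+k]

      Pk≤θ : P k ≤ θ
      Pk≤θ = P[lastBelow]≤ P θ n z≤n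

      P[1+k]≤Pk+n : P (suc k) ≤ P k + n
      P[1+k]≤Pk+n = +-monoʳ-≤ (P k) (A≤n k<n)

      Pu+jn<Pk : P u + j * n < P k
      Pu+jn<Pk = +-cancelʳ-< n (P u + j * n) (P k) (begin-strict
        P u + j * n + n    ≡⟨ +-assoc (P u) (j * n) n ⟩
        P u + (j * n + n)  ≡⟨ cong (P u +_) (+-comm (j * n) n) ⟩
        θ                  <⟨ proj₂ k<n×θ<P[1+k] ⟩
        P (suc k)          ≤⟨ P[1+k]≤Pk+n ⟩
        P k + n            ∎)
        where open ≤-Reasoning

      Pu≤Pk : P u ≤ P k
      Pu≤Pk = ≤-trans (m≤m+n (P u) (j * n)) (<⇒≤ Pu+jn<Pk)

      u<k : u < k
      u<k with k ≤? u
      ... | yes k≤u = ⊥-elim (<⇒≱ (≤-<-trans (m≤m+n (P u) (j * n)) Pu+jn<Pk) (∑<-monoˡ-≤ A k≤u))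
      ... | no  k≰u = ≰⇒> k≰u

      first∈window : InWindow j (proj₁ (pair u))
      first∈window = ∸-inWindow j (P u) Pu+jn<Pk Pk≤θ

      second∈window : InWindow (suc j) (proj₂ (pair u))
      second∈window = ∸-inWindow (suc j) (P u) (proj₂ k<n×θ<P[1+k]) (begin
        P (suc k)               ≤⟨ P[1+k]≤Pk+n ⟩
        P k + n                 ≤⟨ +-monoˡ-≤ n Pk≤θ ⟩
        P u + suc j * n + n     ≡⟨ +-assoc (P u) (suc j * n) n ⟩
        P u + (suc j * n + n)   ≡⟨ cong (P u +_) (+-comm (suc j * n) n) ⟩
        P u + suc (suc j) * n   ∎)
        where open ≤-Reasoning

      pair∈ : pair u ∈ cartesianProduct (within j L) (within (suc j) L)
      pair∈ = ∈-cartesianProduct⁺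
        (∈-filter⁺ (inWindow? j) (block∈L u<k (<⇒≤ k<n)) first∈window)
        (∈-filter⁺ (inWindow? (suc j)) (block∈L (m<n⇒m<1+n u<k) k<n) second∈window)

      second≡first+A : proj₂ (pair u) ≡ proj₁ (pair u) + A k
      second≡first+A = +-∸-comm (A k) Pu≤Pk

    pair-injective : ∀ {x y} → 2 * suc (x + j) ≤ n → 2 * suc (y + j) ≤ n → pair x ≡ pair y → x ≡ y
    pair-injective {x} {y} fx fy pairs≡ =
      P-injective (<⇒≤ (u<n fx)) (<⇒≤ (u<n fy)) (∸-cancelˡ-≡ (Pu≤Pk fx) Py≤Pkx firsts≡)
      where
      open ≡-Reasoning
      crossing≡ : crossing x ≡ crossing y
      crossing≡ = A-injective (k<n fx) (k<n fy) (+-cancelˡ-≡ (proj₁ (pair x)) _ _ (begin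
        proj₁ (pair x) + A (crossing x)   ≡⟨ second≡first+A fx ⟨
        proj₂ (pair x)                    ≡⟨ cong proj₂ pairs≡ ⟩
        proj₂ (pair y)                    ≡⟨ second≡first+A fy ⟩
        proj₁ (pair y) + A (crossing y)   ≡⟨ cong (_+ A (crossing y)) (cong proj₁ pairs≡) ⟨
        proj₁ (pair x) + A (crossing y)   ∎))
      Py≤Pkx : P y ≤ P (crossing x)
      Py≤Pkx = subst (λ k → P y ≤ P k) (sym crossing≡) (Pu≤Pk fy)
      firsts≡ : P (crossing x) ∸ P x ≡ P (crossing x) ∸ P y
      firsts≡ = trans (cong proj₁ pairs≡) (cong (λ k → P k ∸ P y) (sym crossing≡))

  pair-bound : ∀ j m → 2 * (m + j) ≤ n → m ≤ s j * s (suc j)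
  pair-bound j m 2[m+j]≤n = subst (m ≤_) (length-cartesianProduct (within j L) (within (suc j) L))
    (injective-below⇒≤-length pair (λ u<m v<m → pair-injective (fits u<m) (fits v<m))
      (pair∈ ∘ fits))
    where
    open Crossing j
    fits : ∀ {u} → u < m → 2 * suc (u + j) ≤ n
    fits u<m = ≤-trans (*-monoʳ-≤ 2 (+-monoˡ-≤ j u<m)) 2[m+j]≤n

  G≤2*length : G n ≤ 2 * length L
  G≤2*length = begin
    n + ∑[ t < h ] (2 * ⌊√ suc t ⌋)        ≡⟨ cong (n +_) (∑<-reverse h (λ t → 2 * ⌊√ t ⌋)) ⟨
    n + ∑[ j < h ] (2 * ⌊√ (h ∸ j) ⌋)      ≤⟨ +-mono-≤ n≤s₀ (∑<-mono-≤ h adjacent-windows) ⟩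
    s 0 + ∑[ j < h ] (s j + s (suc j))     ≤⟨ ∑<-adjacent h s ⟩
    2 * ∑< (suc h) s                       ≤⟨ *-monoʳ-≤ 2 (∑<-count≤length (suc h) L) ⟩
    2 * length L                           ∎
    where
    open ≤-Reasoning
    h : ℕ
    h = ⌊ n /2⌋
    adjacent-windows : ∀ {j} → j < h → 2 * ⌊√ (h ∸ j) ⌋ ≤ s j + s (suc j)
    adjacent-windows {j} j<h = am-gm ⌊√ (h ∸ j) ⌋ (s j) (s (suc j))
      (≤-trans (proj₁ (⌊√⌋-spec (h ∸ j)))
        (pair-bound j (h ∸ j) (subst (λ m → 2 * m ≤ n) (sym (m∸n+n≡m (<⇒≤ j<h))) (2*⌊n/2⌋≤n n))))

module ℕ-Sum = CommutativeMonoidSum +-0-commutativeMonoid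

at-fromℕ< : ∀ {m i} (b : Fin m → ℕ) (i<m : i < m) → at b i ≡ b (fromℕ< i<m)
at-fromℕ< {suc m} {zero}  b _         = refl
at-fromℕ< {suc m} {suc i} b (s≤s i<m) = at-fromℕ< (b ∘ Fin.suc) i<m

∑<-at : ∀ {m} (b : Fin m → ℕ) → ∑< m (at b) ≡ ℕ-Sum.sum b
∑<-at {zero}  b = refl
∑<-at {suc m} b = trans (∑<-cons m (at b)) (cong (b Fin.zero +_) (∑<-at (b ∘ Fin.suc)))

sum-map-upTo : ∀ (f : ℕ → ℕ) k → sum (map f (upTo k)) ≡ ∑< k f
sum-map-upTo f zero    = refl
sum-map-upTo f (suc k) = begin
  sum (map f (upTo (suc k)))          ≡⟨ cong (sum ∘ map f) (upTo-∷ʳ k) ⟨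
  sum (map f (upTo k ∷ʳ k))           ≡⟨ cong sum (map-++ f (upTo k) (k ∷ [])) ⟩
  sum (map f (upTo k) ++ f k ∷ [])    ≡⟨ sum-++ (map f (upTo k)) (f k ∷ []) ⟩
  sum (map f (upTo k)) + (f k + 0)    ≡⟨ cong₂ _+_ (sum-map-upTo f k) (+-identityʳ (f k)) ⟩
  ∑< k f + f k                        ∎
  where open ≡-Reasoning

take-applyUpTo : ∀ {X : Set} (f : ℕ → X) {u k} → u ≤ k → take u (applyUpTo f k) ≡ applyUpTo f u
take-applyUpTo f z≤n                 = refl
take-applyUpTo f {suc u} {suc k} (s≤s u≤k) = cong (f 0 ∷_) (take-applyUpTo (f ∘ suc) u≤k)

blockSum-split : ∀ {n} (a : Fin n → ℕ) {u v} → u ≤ suc v →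
                 ∑< (suc v) (at a) ≡ ∑< u (at a) + blockSum a u v
blockSum-split a {u} {v} u≤1+v = begin
  ∑< (suc v) (at a)                                  ≡⟨ sum-map-upTo (at a) (suc v) ⟨
  sum (map (at a) is)                                ≡⟨ cong (sum ∘ map (at a)) (take++drop≡id u is) ⟨
  sum (map (at a) (take u is ++ drop u is))          ≡⟨ cong sum (map-++ (at a) (take u is) (drop u is)) ⟩
  sum (map (at a) (take u is) ++ map (at a) (drop u is))
                                                     ≡⟨ sum-++ (map (at a) (take u is)) _ ⟩
  sum (map (at a) (take u is)) + blockSum a u v      ≡⟨ cong (_+ blockSum a u v) prefix ⟩
  ∑< u (at a) + blockSum a u v                       ∎
  where
  open ≡-Reasoning
  is : List ℕ
  is = upTo (suc v)
  prefix : sum (map (at a) (take u is)) ≡ ∑< u (at a)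
  prefix = trans (cong (sum ∘ map (at a)) (take-applyUpTo id u≤1+v)) (sum-map-upTo (at a) u)

blockSum∈S : ∀ {n} (a : Fin n → ℕ) {u v} → u ≤ v → v < n → blockSum a u v ∈ S a
blockSum∈S a {u} {v} u≤v v<n = ∈-deduplicate⁺ _≟_ (∈-concatMap⁺ blocksEndingAt
  (lose (∈-upTo⁺ v<n) (∈-map⁺ (λ u′ → blockSum a u′ v) (∈-upTo⁺ (s≤s u≤v)))))
  where
  blocksEndingAt : ℕ → List ℕ
  blocksEndingAt v′ = map (λ u′ → blockSum a u′ v′) (upTo (suc v′))

prefix-difference∈S : ∀ {n} (a : Fin n → ℕ) {u k} → u < k → k ≤ n →
                      ∑< k (at a) ∸ ∑< u (at a) ∈ S a
prefix-difference∈S a {u} {suc v} (s≤s u≤v) v<n =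
  subst (_∈ S a) block≡difference (blockSum∈S a u≤v v<n)
  where
  open ≡-Reasoning
  block≡difference : blockSum a u v ≡ ∑< (suc v) (at a) ∸ ∑< u (at a)
  block≡difference = begin
    blockSum a u v                                ≡⟨ m+n∸m≡n (∑< u (at a)) _ ⟨
    ∑< u (at a) + blockSum a u v ∸ ∑< u (at a)    ≡⟨ cong (_∸ ∑< u (at a)) (blockSum-split a (m≤n⇒m≤1+n u≤v)) ⟨
    ∑< (suc v) (at a) ∸ ∑< u (at a)               ∎

module _ {n : ℕ} (π : Permutation′ n) where

  permSeq-pos : ∀ {i} → i < n → 0 < at (permSeq π) i
  permSeq-pos i<n = subst (0 <_) (sym (at-fromℕ< (permSeq π) i<n)) z<s

  permSeq-≤ : ∀ {i} → i < n → at (permSeq π) i ≤ n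
  permSeq-≤ i<n = subst (_≤ n) (sym (at-fromℕ< (permSeq π) i<n)) (toℕ<n (π ⟨$⟩ʳ fromℕ< i<n))

  permSeq-injective : ∀ {i k} → i < n → k < n → at (permSeq π) i ≡ at (permSeq π) k → i ≡ k
  permSeq-injective {i} {k} i<n k<n eq = fromℕ<-injective i k i<n k<n (begin
    fromℕ< i<n                        ≡⟨ inverseˡ π ⟨
    π ⟨$⟩ˡ (π ⟨$⟩ʳ fromℕ< i<n)        ≡⟨ cong (π ⟨$⟩ˡ_) (toℕ-injective (suc-injective images≡)) ⟩
    π ⟨$⟩ˡ (π ⟨$⟩ʳ fromℕ< k<n)        ≡⟨ inverseˡ π ⟩
    fromℕ< k<n                        ∎)
    where
    open ≡-Reasoning
    images≡ : permSeq π (fromℕ< i<n) ≡ permSeq π (fromℕ< k<n)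
    images≡ = trans (sym (at-fromℕ< (permSeq π) i<n)) (trans eq (at-fromℕ< (permSeq π) k<n))

  2*∑permSeq≡n*[1+n] : 2 * ∑< n (at (permSeq π)) ≡ n * suc n
  2*∑permSeq≡n*[1+n] = begin
    2 * ∑< n (at (permSeq π))       ≡⟨ cong (2 *_) (∑<-at (permSeq π)) ⟩
    2 * ℕ-Sum.sum (permSeq π)       ≡⟨ cong (2 *_) (ℕ-Sum.sum-permute 1+toℕ π) ⟨
    2 * ℕ-Sum.sum 1+toℕ             ≡⟨ cong (2 *_) (∑<-at 1+toℕ) ⟨
    2 * ∑< n (at 1+toℕ)             ≡⟨ cong (2 *_) (∑<-cong n at-1+toℕ) ⟩
    2 * ∑[ j < n ] suc j            ≡⟨ 2*∑[1+j]≡m*[1+m] n ⟩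
    n * suc n                       ∎
    where
    open ≡-Reasoning
    1+toℕ : Fin n → ℕ
    1+toℕ = suc ∘ toℕ
    at-1+toℕ : ∀ {i} → i < n → at 1+toℕ i ≡ suc i
    at-1+toℕ i<n = trans (at-fromℕ< 1+toℕ i<n) (cong suc (toℕ-fromℕ< i<n))

proposition6p1 : (n : ℕ) → .{{_ : NonZero n}} → (π : Permutation′ n) →
    n ^ 3 ≤ 32 * (card-S (permSeq π) ^ 2)
proposition6p1 n π = begin
  n ^ 3                       ≤⟨ n^3≤8*G^2 n ⟩
  8 * G n ^ 2                 ≤⟨ *-monoʳ-≤ 8 (^-monoˡ-≤ 2 G≤2*length) ⟩
  8 * (2 * card-S a) ^ 2      ≡⟨ regroup (card-S a) ⟩
  32 * card-S a ^ 2           ∎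
  where
  open ≤-Reasoning
  a : Fin n → ℕ
  a = permSeq π
  open BlockSumWindows n (at a) (permSeq-pos π) (permSeq-≤ π) (permSeq-injective π)
    (≤-reflexive (sym (2*∑permSeq≡n*[1+n] π))) (S a) (prefix-difference∈S a)
  regroup : ∀ c → 8 * (2 * c * (2 * c * 1)) ≡ 32 * (c * (c * 1))
  regroup = solve-∀
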